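{- Let $s_1,\dots,s_k$ be positive reals and let $x_1\ge x_2\ge\cdots\ge x_k\ge0$ be reals such that for every $m\in\{1,\dots,k\}$, \[\sum_{i=1}^m x_i\le\sum_{i=1}^k\min\{i,m\}\,s_i.\] Then \[\sum_{i=1}^k x_i^2\le\sum_{i=1}^k\Big(\sum_{j=i}^k s_j\Big)^2,\] and equality holds if and only if $x_i=s_i+s_{i+1}+\cdots+s_k$ for all $i\in\{1,\dots,k\}$. -}

module Defs where

open import Level using (Level; _⊔_) renaming (suc to lsuc)
open import Data.Nat as ℕ using (ℕ; suc; _⊓_; _≤ᵇ_)
open import Data.Fin using (Fin; toℕ)
open import Data.Bool using (if_then_else_)
open import Data.Product using (_×_; ∃)
open import Relation.Nullary using (¬_)
open import Relation.Binary using (Rel; IsTotalOrder)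
open import Algebra.Bundles using (CommutativeRing)
import Algebra.Properties.Monoid.Sum as MonoidSum
import Algebra.Definitions.RawMonoid as RawMonoidDefs

record OrderedField (c ℓ₁ ℓ₂ : Level) : Set (lsuc (c ⊔ ℓ₁ ⊔ ℓ₂)) where
  field
    commutativeRing : CommutativeRing c ℓ₁
  open CommutativeRing commutativeRing public
  field
    _≤_           : Rel Carrier ℓ₂
    isTotalOrder  : IsTotalOrder _≈_ _≤_
    +-mono-≤      : ∀ {x y} z → x ≤ y → (x + z) ≤ (y + z)
    *-nonneg      : ∀ {x y} → 0# ≤ x → 0# ≤ y → 0# ≤ (x * y)
    0≉1           : ¬ (0# ≈ 1#)
    *-inverse     : ∀ x → ¬ (x ≈ 0#) → ∃ λ y → (x * y) ≈ 1#

  infix 4 _<_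
  _<_ : Rel Carrier (ℓ₁ ⊔ ℓ₂)
  x < y = (x ≤ y) × ¬ (x ≈ y)

  open MonoidSum +-monoid public using (sum)
  open RawMonoidDefs +-rawMonoid public using ()
    renaming (_×_ to _·ℕ_)

  -- Indices 1..k of the paper are represented by Fin k = {0,…,k-1}.

  prefixSum : ∀ {k} → (Fin k → Carrier) → Fin k → Carrier
  prefixSum x m = sum λ i → if toℕ i ≤ᵇ toℕ m then x i else 0#

  tailSum : ∀ {k} → (Fin k → Carrier) → Fin k → Carrier
  tailSum s i = sum λ j → if toℕ i ≤ᵇ toℕ j then s j else 0#

  -- Σ_{i=1}^{k} min{i,m} s_i   (paper indices i,m = Fin indices + 1)
  minWeightedSum : ∀ {k} → (Fin k → Carrier) → Fin k → Carrier
  minWeightedSum s m = sum λ i → suc (toℕ i ⊓ toℕ m) ·ℕ s i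

-- Write t i = Σ_{j ≥ i} s j for the tail sums.  Comparing the sum of
-- squares of x with that of t rests on the difference of squares
--     t i * t i ≈ x i * x i + (t i - x i) * (t i + x i),
-- so Σ t² ≈ Σ x² + Σ d i * c i  with deficits d = t - x and weights
-- c = t + x.  The weights are positive and strictly decreasing (t is, as
-- s is positive, and x is nonincreasing), while the hypothesis says that
-- every partial sum of the deficits is nonnegative, because
-- Σ_i min(i,m) s i equals the partial sum Σ_{i ≤ m} t i.  Abel summation
-- then shows Σ d c ≥ 0, with equality only if every partial sum of d, and
-- hence every d i, vanishes.

module Submission where

open import Defs
open import Data.Nat as ℕ using (ℕ; zero; suc; z≤n; s≤s; _⊓_)
  renaming (_≤_ to _≤ℕ_; _<_ to _<ℕ_)
open import Data.Nat.Properties using (⊓-zeroʳ; <⇒≤; m≤n⇒m<n∨m≡n)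
open import Data.Fin using (Fin; toℕ; zero; suc)
open import Data.Fin.Properties using (toℕ-injective)
open import Data.Bool using (true; false; if_then_else_)
open import Data.Product using (_×_; _,_; proj₁)
open import Data.Sum using (inj₁; inj₂)
open import Function using (_∘_)
open import Function.Bundles using (_⇔_; mk⇔)
open import Relation.Nullary using (¬_)
open import Relation.Binary.PropositionalEquality as ≡ using (_≡_)
open import Relation.Binary.Structures using (IsTotalOrder)

module OrderedFieldSums {c ℓ₁ ℓ₂} (F : OrderedField c ℓ₁ ℓ₂) where
  open OrderedField F hiding (zero)
  open IsTotalOrder isTotalOrder public using (antisym; ≤-respˡ-≈; ≤-respʳ-≈)
    renaming (trans to ≤-trans; refl to ≤-refl)
  open import Algebra.Properties.AbelianGroup +-abelianGroup public
    using (//-rightDividesˡ; xyx⁻¹≈y; ∙-cancelʳ; identityˡ-unique; identityʳ-unique; x∙y⁻¹≈ε⇒x≈y)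
  open import Algebra.Properties.Monoid.Sum +-monoid using (sum-cong-≋; sum-replicate-zero)
  open import Algebra.Properties.CommutativeMonoid.Sum +-commutativeMonoid using (∑-distrib-+)
  open import Algebra.Solver.Ring.NaturalCoefficients.Default commutativeSemiring
  open import Relation.Binary.Reasoning.Setoid setoid

  Antitone : ∀ {k} → (Fin k → Carrier) → Set _
  Antitone c = ∀ i j → toℕ i ≤ℕ toℕ j → c j ≤ c i

  StrictlyAntitone : ∀ {k} → (Fin k → Carrier) → Set _
  StrictlyAntitone c = ∀ i j → toℕ i <ℕ toℕ j → c j < c i

  -- Ring identities.  Subtraction is handled by writing y ≈ (y - x) + x
  -- and calling the semiring solver on the resulting expression.

  minus-plus : ∀ y x → y ≈ (y - x) + x
  minus-plus y x = sym (//-rightDividesˡ x y)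

  difference-of-squares : ∀ t x → t * t ≈ x * x + (t - x) * (t + x)
  difference-of-squares t x = begin
    t * t                                 ≈⟨ *-cong (minus-plus t x) (minus-plus t x) ⟩
    (t - x + x) * (t - x + x)             ≈⟨ expand (t - x) x ⟩
    x * x + (t - x) * ((t - x + x) + x)   ≈⟨ +-congˡ (*-congˡ (+-congʳ (sym (minus-plus t x)))) ⟩
    x * x + (t - x) * (t + x)             ∎
    where
    expand : ∀ d x → (d + x) * (d + x) ≈ x * x + d * ((d + x) + x)
    expand = solve 2 (λ d x → (d :+ x) :* (d :+ x) := x :* x :+ d :* ((d :+ x) :+ x)) refl

  -- One step of summation by parts: the accumulated partial sum a + d is
  -- paired with the drop c₀ - c₁ and then carried on to the weight c₁.
  parts-step : ∀ a d c₀ c₁ S → a * c₀ + (d * c₀ + S) ≈ (a + d) * (c₀ - c₁) + ((a + d) * c₁ + S)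
  parts-step a d c₀ c₁ S = begin
    a * c₀ + (d * c₀ + S)                     ≈⟨ +-cong (*-congˡ split) (+-congʳ (*-congˡ split)) ⟩
    a * (w + c₁) + (d * (w + c₁) + S)         ≈⟨ regroup a d w c₁ S ⟩
    (a + d) * (c₀ - c₁) + ((a + d) * c₁ + S)  ∎
    where
    w : Carrier
    w = c₀ - c₁
    split : c₀ ≈ w + c₁
    split = minus-plus c₀ c₁
    regroup : ∀ a d w c₁ S → a * (w + c₁) + (d * (w + c₁) + S) ≈ (a + d) * w + ((a + d) * c₁ + S)
    regroup = solve 5 (λ a d w c₁ S → a :* (w :+ c₁) :+ (d :* (w :+ c₁) :+ S)
                                   := (a :+ d) :* w :+ ((a :+ d) :* c₁ :+ S)) refl

  parts-last : ∀ a d c₀ → a * c₀ + (d * c₀ + 0#) ≈ (a + d) * c₀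
  parts-last = solve 3 (λ a d c₀ → a :* c₀ :+ (d :* c₀ :+ con 0) := (a :+ d) :* c₀) refl

  +-mono : ∀ {a b x y} → a ≤ b → x ≤ y → (a + x) ≤ (b + y)
  +-mono {a} {b} {x} {y} a≤b x≤y = ≤-trans (+-mono-≤ x a≤b)
    (≤-respʳ-≈ (+-comm y b) (≤-respˡ-≈ (+-comm x b) (+-mono-≤ b x≤y)))

  x≤x+y : ∀ x {y} → 0# ≤ y → x ≤ (x + y)
  x≤x+y x 0≤y = ≤-respˡ-≈ (+-identityʳ x) (+-mono ≤-refl 0≤y)

  +-nonneg : ∀ {x y} → 0# ≤ x → 0# ≤ y → 0# ≤ (x + y)
  +-nonneg {x} 0≤x 0≤y = ≤-trans 0≤x (x≤x+y x 0≤y)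

  x≤x+y⇒0≤y : ∀ x y → x ≤ (x + y) → 0# ≤ y
  x≤x+y⇒0≤y x y x≤x+y = ≤-respˡ-≈ (-‿inverseʳ x) (≤-respʳ-≈ (xyx⁻¹≈y x y) (+-mono-≤ (- x) x≤x+y))

  x≤y⇒0≤y-x : ∀ {x y} → x ≤ y → 0# ≤ (y - x)
  x≤y⇒0≤y-x {x} x≤y = ≤-respˡ-≈ (-‿inverseʳ x) (+-mono-≤ (- x) x≤y)

  nonneg-sum-zero : ∀ {u v} → 0# ≤ u → 0# ≤ v → u + v ≈ 0# → u ≈ 0#
  nonneg-sum-zero {u} 0≤u 0≤v u+v≈0 = antisym (≤-respʳ-≈ u+v≈0 (x≤x+y u 0≤v)) 0≤u

  *-cancel-nonzero : ∀ a y → a * y ≈ 0# → ¬ (y ≈ 0#) → a ≈ 0#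
  *-cancel-nonzero a y ay≈0 y≉0 with *-inverse y y≉0
  ... | y⁻¹ , yy⁻¹≈1 = begin
    a               ≈⟨ sym (*-identityʳ a) ⟩
    a * 1#          ≈⟨ *-congˡ (sym yy⁻¹≈1) ⟩
    a * (y * y⁻¹)   ≈⟨ sym (*-assoc a y y⁻¹) ⟩
    (a * y) * y⁻¹   ≈⟨ *-congʳ ay≈0 ⟩
    0# * y⁻¹        ≈⟨ zeroˡ y⁻¹ ⟩
    0#              ∎

  <-≉ : ∀ {x y} → x < y → ¬ (y ≈ x)
  <-≉ (_ , x≉y) y≈x = x≉y (sym y≈x)

  <-≤-trans : ∀ {x y z} → x < y → y ≤ z → x < z
  <-≤-trans (x≤y , x≉y) y≤z = ≤-trans x≤y y≤z , λ x≈z → x≉y (antisym x≤y (≤-respʳ-≈ (sym x≈z) y≤z))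

  ≤-<-trans : ∀ {x y z} → x ≤ y → y < z → x < z
  ≤-<-trans x≤y (y≤z , y≉z) = ≤-trans x≤y y≤z , λ x≈z → y≉z (antisym y≤z (≤-respˡ-≈ x≈z x≤y))

  <-resp-≈ : ∀ {x x′ y y′} → x ≈ x′ → y ≈ y′ → x < y → x′ < y′
  <-resp-≈ x≈x′ y≈y′ (x≤y , x≉y) =
    ≤-respˡ-≈ x≈x′ (≤-respʳ-≈ y≈y′ x≤y) , λ x′≈y′ → x≉y (trans x≈x′ (trans x′≈y′ (sym y≈y′)))

  y<x+y : ∀ {x} y → 0# < x → y < (x + y)
  y<x+y {x} y (0≤x , 0≉x) =
    ≤-respˡ-≈ (+-identityˡ y) (+-mono-≤ y 0≤x) , λ y≈x+y → 0≉x (sym (identityˡ-unique x y (sym y≈x+y)))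

  +-mono-<-≤ : ∀ {a b x y} → a < b → x ≤ y → (a + x) < (b + y)
  +-mono-<-≤ {a} {b} {x} (a≤b , a≉b) x≤y =
    <-≤-trans (+-mono-≤ x a≤b , λ eq → a≉b (∙-cancelʳ x a b eq)) (+-mono ≤-refl x≤y)

  sum-cong : ∀ {n} {f g : Fin n → Carrier} → (∀ i → f i ≈ g i) → sum f ≈ sum g
  sum-cong = sum-cong-≋

  sum-nonneg : ∀ {n} (f : Fin n → Carrier) → (∀ i → 0# ≤ f i) → 0# ≤ sum f
  sum-nonneg {zero} f _ = ≤-refl
  sum-nonneg {suc n} f 0≤f = +-nonneg (0≤f zero) (sum-nonneg (f ∘ suc) (0≤f ∘ suc))

  mask-cong : ∀ b {x y} → x ≈ y → (if b then x else 0#) ≈ (if b then y else 0#)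
  mask-cong true x≈y = x≈y
  mask-cong false _ = refl

  mask-+ : ∀ b x y → (if b then x + y else 0#) ≈ (if b then x else 0#) + (if b then y else 0#)
  mask-+ true x y = refl
  mask-+ false x y = sym (+-identityʳ 0#)

  mask-shift : ∀ {k} (i j : Fin k) x → (if toℕ (suc i) ℕ.≤ᵇ toℕ (suc j) then x else 0#) ≈ (if toℕ i ℕ.≤ᵇ toℕ j then x else 0#)
  mask-shift i j x = reflexive (≡.cong (λ b → if b then x else 0#) (≤ᵇ-suc (toℕ i) (toℕ j)))
    where
    ≤ᵇ-suc : ∀ a b → (suc a ℕ.≤ᵇ suc b) ≡ (a ℕ.≤ᵇ b)
    ≤ᵇ-suc zero b = ≡.refl
    ≤ᵇ-suc (suc a) b = ≡.refl

  prefixSum-cong : ∀ {k} {f g : Fin k → Carrier} → (∀ i → f i ≈ g i) → ∀ m → prefixSum f m ≈ prefixSum g m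
  prefixSum-cong f≈g m = sum-cong (λ i → mask-cong _ (f≈g i))

  prefixSum-+ : ∀ {k} (f g : Fin k → Carrier) m → prefixSum (λ i → f i + g i) m ≈ prefixSum f m + prefixSum g m
  prefixSum-+ f g m = trans (sum-cong (λ i → mask-+ _ (f i) (g i))) (∑-distrib-+ (upTo m f) (upTo m g))
    where
    upTo : ∀ {k} → Fin k → (Fin k → Carrier) → Fin k → Carrier
    upTo m h i = if toℕ i ℕ.≤ᵇ toℕ m then h i else 0#

  prefixSum-zero : ∀ {k} (f : Fin (suc k) → Carrier) → prefixSum f zero ≈ f zero
  prefixSum-zero {k} f = trans (+-congˡ (sum-replicate-zero k)) (+-identityʳ (f zero))

  prefixSum-suc : ∀ {k} (f : Fin (suc k) → Carrier) m → prefixSum f (suc m) ≈ f zero + prefixSum (f ∘ suc) m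
  prefixSum-suc f m = +-congˡ (sum-cong (λ i → mask-shift i m (f (suc i))))

  vanishing-prefixSums : ∀ {k} (d : Fin k → Carrier) → (∀ m → prefixSum d m ≈ 0#) → ∀ i → d i ≈ 0#
  vanishing-prefixSums d P≈0 zero = trans (sym (prefixSum-zero d)) (P≈0 zero)
  vanishing-prefixSums d P≈0 (suc i) = vanishing-prefixSums (d ∘ suc) tail≈0 i
    where
    d₀≈0 : d zero ≈ 0#
    d₀≈0 = vanishing-prefixSums d P≈0 zero
    tail≈0 : ∀ m → prefixSum (d ∘ suc) m ≈ 0#
    tail≈0 m = begin
      prefixSum (d ∘ suc) m           ≈⟨ sym (+-identityˡ _) ⟩
      0# + prefixSum (d ∘ suc) m      ≈⟨ +-congʳ (sym d₀≈0) ⟩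
      d zero + prefixSum (d ∘ suc) m  ≈⟨ sym (prefixSum-suc d m) ⟩
      prefixSum d (suc m)             ≈⟨ P≈0 (suc m) ⟩
      0#                              ∎

  tailSum-suc : ∀ {k} (s : Fin (suc k) → Carrier) i → tailSum s (suc i) ≈ tailSum (s ∘ suc) i
  tailSum-suc s i = trans (+-identityˡ _) (sum-cong (λ j → mask-shift i j (s (suc j))))

  minWeightedSum≈prefixSum-tailSum : ∀ {k} (s : Fin k → Carrier) m → minWeightedSum s m ≈ prefixSum (tailSum s) m
  minWeightedSum≈prefixSum-tailSum s zero = begin
    minWeightedSum s zero          ≈⟨ sum-cong weight-one ⟩
    tailSum s zero                 ≈⟨ sym (prefixSum-zero (tailSum s)) ⟩
    prefixSum (tailSum s) zero     ∎
    where
    weight-one : ∀ i → suc (toℕ i ⊓ 0) ·ℕ s i ≈ s i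
    weight-one i = trans (reflexive (≡.cong (λ n → suc n ·ℕ s i) (⊓-zeroʳ (toℕ i)))) (+-identityʳ (s i))
  minWeightedSum≈prefixSum-tailSum s (suc m) = begin
    (s zero + 0#) + sum (λ i → s (suc i) + (suc (toℕ i ⊓ toℕ m) ·ℕ s (suc i)))
      ≈⟨ +-cong (+-identityʳ (s zero)) (∑-distrib-+ (s ∘ suc) (λ i → suc (toℕ i ⊓ toℕ m) ·ℕ s (suc i))) ⟩
    s zero + (sum (s ∘ suc) + minWeightedSum (s ∘ suc) m)
      ≈⟨ sym (+-assoc (s zero) _ _) ⟩
    tailSum s zero + minWeightedSum (s ∘ suc) m
      ≈⟨ +-congˡ (minWeightedSum≈prefixSum-tailSum (s ∘ suc) m) ⟩
    tailSum s zero + prefixSum (tailSum (s ∘ suc)) m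
      ≈⟨ +-congˡ (prefixSum-cong (λ i → sym (tailSum-suc s i)) m) ⟩
    tailSum s zero + prefixSum (tailSum s ∘ suc) m
      ≈⟨ sym (prefixSum-suc (tailSum s) m) ⟩
    prefixSum (tailSum s) (suc m) ∎

  tailSum≤sum : ∀ {k} (s : Fin k → Carrier) → (∀ i → 0# ≤ s i) → ∀ i → tailSum s i ≤ sum s
  tailSum≤sum s 0≤s zero = ≤-refl
  tailSum≤sum s 0≤s (suc i) = ≤-respˡ-≈ (sym (tailSum-suc s i))
    (≤-trans (tailSum≤sum (s ∘ suc) (0≤s ∘ suc) i) (≤-respˡ-≈ (+-identityˡ _) (+-mono-≤ _ (0≤s zero))))

  tailSum-positive : ∀ {k} (s : Fin k → Carrier) → (∀ i → 0# < s i) → ∀ i → 0# < tailSum s i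
  tailSum-positive s 0<s zero = <-≤-trans (0<s zero) (x≤x+y (s zero) (sum-nonneg (s ∘ suc) (proj₁ ∘ 0<s ∘ suc)))
  tailSum-positive s 0<s (suc i) = <-resp-≈ refl (sym (tailSum-suc s i)) (tailSum-positive (s ∘ suc) (0<s ∘ suc) i)

  tailSum-strictlyAntitone : ∀ {k} (s : Fin k → Carrier) → (∀ i → 0# < s i) → StrictlyAntitone (tailSum s)
  tailSum-strictlyAntitone s 0<s zero (suc j) _ =
    ≤-<-trans (≤-respˡ-≈ (sym (tailSum-suc s j)) (tailSum≤sum (s ∘ suc) (proj₁ ∘ 0<s ∘ suc) j))
              (y<x+y (sum (s ∘ suc)) (0<s zero))
  tailSum-strictlyAntitone s 0<s (suc i) (suc j) (s≤s i<j) =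
    <-resp-≈ (sym (tailSum-suc s j)) (sym (tailSum-suc s i)) (tailSum-strictlyAntitone (s ∘ suc) (0<s ∘ suc) i j i<j)

  strictlyAntitone⇒antitone : ∀ {k} {c : Fin k → Carrier} → StrictlyAntitone c → Antitone c
  strictlyAntitone⇒antitone c↓ i j i≤j with m≤n⇒m<n∨m≡n i≤j
  ... | inj₁ i<j = proj₁ (c↓ i j i<j)
  ... | inj₂ i≡j rewrite toℕ-injective i≡j = ≤-refl

  -- Abel summation.  The scalar a accumulates the partial sums of d that
  -- have already been passed; peeling off the first index moves d 0 into it.

  accumulate-zero : ∀ {k} a (d : Fin (suc k) → Carrier) → a + prefixSum d zero ≈ a + d zero
  accumulate-zero a d = +-congˡ (prefixSum-zero d)

  accumulate-suc : ∀ {k} a (d : Fin (suc k) → Carrier) m →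
                   a + prefixSum d (suc m) ≈ (a + d zero) + prefixSum (d ∘ suc) m
  accumulate-suc a d m = trans (+-congˡ (prefixSum-suc d m)) (sym (+-assoc a (d zero) _))

  abel-nonneg : ∀ {k} (c d : Fin (suc k) → Carrier) a → Antitone c → (∀ i → 0# ≤ c i) →
                (∀ m → 0# ≤ (a + prefixSum d m)) → 0# ≤ (a * c zero + sum (λ i → d i * c i))
  abel-nonneg {zero} c d a _ 0≤c 0≤P =
    ≤-respʳ-≈ (sym (parts-last a (d zero) (c zero))) (*-nonneg (≤-respʳ-≈ (accumulate-zero a d) (0≤P zero)) (0≤c zero))
  abel-nonneg {suc k} c d a c↓ 0≤c 0≤P =
    ≤-respʳ-≈ (sym (parts-step a (d zero) (c zero) (c (suc zero)) _))
      (+-nonneg (*-nonneg (≤-respʳ-≈ (accumulate-zero a d) (0≤P zero)) (x≤y⇒0≤y-x (c↓ zero (suc zero) z≤n)))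
                (abel-nonneg (c ∘ suc) (d ∘ suc) (a + d zero) (λ i j → c↓ (suc i) (suc j) ∘ s≤s) (0≤c ∘ suc)
                             (λ m → ≤-respʳ-≈ (accumulate-suc a d m) (0≤P (suc m)))))

  abel-equality : ∀ {k} (c d : Fin (suc k) → Carrier) a → StrictlyAntitone c → (∀ i → 0# < c i) →
                  (∀ m → 0# ≤ (a + prefixSum d m)) → a * c zero + sum (λ i → d i * c i) ≈ 0# →
                  ∀ m → a + prefixSum d m ≈ 0#
  abel-equality {zero} c d a _ 0<c _ sum≈0 zero =
    trans (accumulate-zero a d)
          (*-cancel-nonzero (a + d zero) (c zero) (trans (sym (parts-last a (d zero) (c zero))) sum≈0) (<-≉ (0<c zero)))
  abel-equality {suc k} c d a c↓ 0<c 0≤P sum≈0 = vanishes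
    where
    A w v : Carrier
    A = a + d zero
    w = c zero - c (suc zero)
    v = A * c (suc zero) + sum (λ i → d (suc i) * c (suc i))
    0≤A : 0# ≤ A
    0≤A = ≤-respʳ-≈ (accumulate-zero a d) (0≤P zero)
    0≤P-tail : ∀ m → 0# ≤ (A + prefixSum (d ∘ suc) m)
    0≤P-tail m = ≤-respʳ-≈ (accumulate-suc a d m) (0≤P (suc m))
    c↓-tail : StrictlyAntitone (c ∘ suc)
    c↓-tail i j = c↓ (suc i) (suc j) ∘ s≤s
    0≤Aw : 0# ≤ (A * w)
    0≤Aw = *-nonneg 0≤A (x≤y⇒0≤y-x (proj₁ (c↓ zero (suc zero) (s≤s z≤n))))
    0≤v : 0# ≤ v
    0≤v = abel-nonneg (c ∘ suc) (d ∘ suc) A (strictlyAntitone⇒antitone c↓-tail) (proj₁ ∘ 0<c ∘ suc) 0≤P-tail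
    Aw+v≈0 : A * w + v ≈ 0#
    Aw+v≈0 = trans (sym (parts-step a (d zero) (c zero) (c (suc zero)) _)) sum≈0
    w≉0 : ¬ (w ≈ 0#)
    w≉0 w≈0 = <-≉ (c↓ zero (suc zero) (s≤s z≤n)) (x∙y⁻¹≈ε⇒x≈y (c zero) (c (suc zero)) w≈0)
    A≈0 : A ≈ 0#
    A≈0 = *-cancel-nonzero A w (nonneg-sum-zero 0≤Aw 0≤v Aw+v≈0) w≉0
    v≈0 : v ≈ 0#
    v≈0 = nonneg-sum-zero 0≤v 0≤Aw (trans (+-comm v (A * w)) Aw+v≈0)
    vanishes : ∀ m → a + prefixSum d m ≈ 0#
    vanishes zero = trans (accumulate-zero a d) A≈0
    vanishes (suc m) = trans (accumulate-suc a d m)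
                             (abel-equality (c ∘ suc) (d ∘ suc) A c↓-tail (0<c ∘ suc) 0≤P-tail v≈0 m)

  drop-accumulator : ∀ {k} (c : Fin (suc k) → Carrier) S → 0# * c zero + S ≈ S
  drop-accumulator c S = trans (+-congʳ (zeroˡ (c zero))) (+-identityˡ S)

  abel-nonneg₀ : ∀ {k} (c d : Fin k → Carrier) → Antitone c → (∀ i → 0# ≤ c i) →
                 (∀ m → 0# ≤ prefixSum d m) → 0# ≤ sum (λ i → d i * c i)
  abel-nonneg₀ {zero} _ _ _ _ _ = ≤-refl
  abel-nonneg₀ {suc k} c d c↓ 0≤c 0≤P = ≤-respʳ-≈ (drop-accumulator c _)
    (abel-nonneg c d 0# c↓ 0≤c (λ m → ≤-respʳ-≈ (sym (+-identityˡ _)) (0≤P m)))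

  abel-equality₀ : ∀ {k} (c d : Fin k → Carrier) → StrictlyAntitone c → (∀ i → 0# < c i) →
                   (∀ m → 0# ≤ prefixSum d m) → sum (λ i → d i * c i) ≈ 0# → ∀ i → d i ≈ 0#
  abel-equality₀ {zero} _ _ _ _ _ _ ()
  abel-equality₀ {suc k} c d c↓ 0<c 0≤P sum≈0 = vanishing-prefixSums d (λ m →
    trans (sym (+-identityˡ _))
          (abel-equality c d 0# c↓ 0<c (λ m′ → ≤-respʳ-≈ (sym (+-identityˡ _)) (0≤P m′))
                         (trans (drop-accumulator c _) sum≈0) m))

  sum-of-squares-split : ∀ {k} (t x : Fin k → Carrier) →
    sum (λ i → t i * t i) ≈ sum (λ i → x i * x i) + sum (λ i → (t i - x i) * (t i + x i))
  sum-of-squares-split t x = trans (sum-cong (λ i → difference-of-squares (t i) (x i)))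
    (∑-distrib-+ (λ i → x i * x i) (λ i → (t i - x i) * (t i + x i)))

  deficit-prefixSum-nonneg : ∀ {k} (t x : Fin k → Carrier) → (∀ m → prefixSum x m ≤ prefixSum t m) →
                             ∀ m → 0# ≤ prefixSum (λ i → t i - x i) m
  deficit-prefixSum-nonneg t x P[x]≤P[t] m =
    x≤x+y⇒0≤y (prefixSum x m) _ (≤-respʳ-≈ P[t]≈P[x]+P[t-x] (P[x]≤P[t] m))
    where
    P[t]≈P[x]+P[t-x] : prefixSum t m ≈ prefixSum x m + prefixSum (λ i → t i - x i) m
    P[t]≈P[x]+P[t-x] = begin
      prefixSum t m                              ≈⟨ prefixSum-cong (λ i → trans (minus-plus (t i) (x i)) (+-comm _ (x i))) m ⟩
      prefixSum (λ i → x i + (t i - x i)) m      ≈⟨ prefixSum-+ x (λ i → t i - x i) m ⟩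
      prefixSum x m + prefixSum (λ i → t i - x i) m ∎

lemma13 : ∀ {c ℓ₁ ℓ₂} (F : OrderedField c ℓ₁ ℓ₂) → let open OrderedField F in
          (k : ℕ) (s x : Fin k → Carrier) →
          (∀ i → 0# < s i) →
          (∀ i j → toℕ i ≤ℕ toℕ j → x j ≤ x i) →
          (∀ i → 0# ≤ x i) →
          (∀ m → prefixSum x m ≤ minWeightedSum s m) →
          (sum (λ i → x i * x i) ≤ sum (λ i → tailSum s i * tailSum s i))
          × ((sum (λ i → x i * x i) ≈ sum (λ i → tailSum s i * tailSum s i))
             ⇔ (∀ i → x i ≈ tailSum s i))
lemma13 F k s x 0<s x↓ 0≤x x-bound = inequality , mk⇔ x≈t-if-equal equal-if-x≈t
  where
  open OrderedField F hiding (zero)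
  open OrderedFieldSums F
  t d c : Fin k → Carrier
  t = tailSum s
  d i = t i - x i
  c i = t i + x i
  c↓ : StrictlyAntitone c
  c↓ i j i<j = +-mono-<-≤ (tailSum-strictlyAntitone s 0<s i j i<j) (x↓ i j (<⇒≤ i<j))
  0<c : ∀ i → 0# < c i
  0<c i = <-≤-trans (tailSum-positive s 0<s i) (x≤x+y (t i) (0≤x i))
  0≤P[d] : ∀ m → 0# ≤ prefixSum d m
  0≤P[d] = deficit-prefixSum-nonneg t x (λ m → ≤-respʳ-≈ (minWeightedSum≈prefixSum-tailSum s m) (x-bound m))
  0≤Σdc : 0# ≤ sum (λ i → d i * c i)
  0≤Σdc = abel-nonneg₀ c d (strictlyAntitone⇒antitone c↓) (proj₁ ∘ 0<c) 0≤P[d]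
  inequality : sum (λ i → x i * x i) ≤ sum (λ i → t i * t i)
  inequality = ≤-respʳ-≈ (sym (sum-of-squares-split t x)) (x≤x+y _ 0≤Σdc)
  x≈t-if-equal : sum (λ i → x i * x i) ≈ sum (λ i → t i * t i) → ∀ i → x i ≈ t i
  x≈t-if-equal Σx²≈Σt² i = sym (x∙y⁻¹≈ε⇒x≈y (t i) (x i) (abel-equality₀ c d c↓ 0<c 0≤P[d] Σdc≈0 i))
    where
    Σdc≈0 : sum (λ i → d i * c i) ≈ 0#
    Σdc≈0 = identityʳ-unique _ _ (sym (trans Σx²≈Σt² (sum-of-squares-split t x)))
  equal-if-x≈t : (∀ i → x i ≈ t i) → sum (λ i → x i * x i) ≈ sum (λ i → t i * t i)
  equal-if-x≈t x≈t = sum-cong (λ i → *-cong (x≈t i) (x≈t i))
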